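{- For any bipartite graph $G=(L,R,E)$ with parts $L,R$ and edge set $E$, there is an induced subgraph $G'=(L',R',E')$ of $G$ (with $L'\subseteq L$, $R'\subseteq R$) such that \[ \min_{v\in L'}\deg(v)\cdot \min_{u\in R'}\deg(u) > \frac{|E|^2}{4|L|\,|R|}, \qquad\text{and}\qquad \frac{|E'|^2}{|L'|\,|R'|} \ge \frac{|E|^2}{|L|\,|R|}, \] where degrees are taken in $G'$. -}

module Defs where

open import Data.Nat using (ℕ; zero; suc; _+_)
open import Data.Bool using (Bool; true; false; _∧_; if_then_else_)
open import Data.Fin using (Fin)
import Data.Fin as F
open import Data.Fin.Subset using (Subset; _∈_)
open import Data.Vec using (lookup)
import Data.Vec

record BipartiteGraph : Set where
  field
    nL : ℕ
    nR : ℕ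
    adj : Fin nL → Fin nR → Bool
open BipartiteGraph public

count : ∀ {k} → (Fin k → Bool) → ℕ
count {zero} p = 0
count {suc k} p = (if p F.zero then 1 else 0) + count (λ i → p (F.suc i))

-- the induced subgraph G[L' ∪ R'] is determined by L' ⊆ L, R' ⊆ R.
-- degree of v (∈ L') in the induced subgraph G[L',R']
degL : (G : BipartiteGraph) → Subset (nR G) → Fin (nL G) → ℕ
degL G R' v = count (λ u → lookup R' u ∧ adj G v u)

degR : (G : BipartiteGraph) → Subset (nL G) → Fin (nR G) → ℕ
degR G L' u = count (λ v → lookup L' v ∧ adj G v u)

sumF : ∀ {k} → (Fin k → ℕ) → ℕ
sumF {zero} f = 0
sumF {suc k} f = f F.zero + sumF (λ i → f (F.suc i))

numEdges : BipartiteGraph → ℕ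
numEdges G = sumF (λ v → count (adj G v))

edgesIn : (G : BipartiteGraph) → Subset (nL G) → Subset (nR G) → ℕ
edgesIn G L' R' = sumF (λ v → if lookup L' v then degL G R' v else 0)

-- minimum of f over the elements of a subset S (0 if S is empty; the
-- statement only uses it for nonempty S)
open import Data.Maybe using (Maybe; just; nothing; maybe)
open import Data.Nat using (_⊓_)

minOver′ : ∀ {k} → Subset k → (Fin k → ℕ) → Maybe ℕ
minOver′ {zero} S f = nothing
minOver′ {suc k} S f with lookup S F.zero | minOver′ {k} (Data.Vec.tail S) (λ i → f (F.suc i))
... | false | r = r
... | true | nothing = just (f F.zero)
... | true | just m = just (f F.zero ⊓ m)

minOver : ∀ {k} → Subset k → (Fin k → ℕ) → ℕ
minOver S f = maybe (λ m → m) 0 (minOver′ S f)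

{-# OPTIONS --safe #-}
-- Greedily delete a vertex v of L′ with deg v ≤ |E′| / (2 |L′|), or a vertex
-- u of R′ with deg u ≤ |E′| / (2 |R′|), while there is one.  Such a deletion
-- never lowers the density |E′|² / (|L′| |R′|) and never deletes the last
-- edge.  When no deletion is possible, every degree in L′ exceeds
-- |E′| / (2 |L′|) and every degree in R′ exceeds |E′| / (2 |R′|), so the
-- product of the minimum degrees exceeds |E′|² / (4 |L′| |R′|), which is at
-- least |E|² / (4 |L| |R|).

module Submission where

open import Defs
open import Data.Nat using (ℕ; _*_; _^_; _<_; _≤_)
open import Data.Product using (∃; ∃₂; _×_)
open import Data.Fin.Subset using (Subset; ∣_∣; Nonempty)

open import Algebra.Bundles using (CommutativeMonoid)
open import Data.Bool using (Bool; true; false; _∧_; if_then_else_)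
open import Data.Bool.Properties using (_≟_; ∧-commutativeMonoid)
open import Data.Fin using (Fin; zero; suc)
open import Data.Fin.Properties using (any?)
open import Data.Fin.Subset using (⊤)
open import Data.Fin.Subset.Properties using (∣⊤∣≡n)
open import Data.Maybe using (just; nothing)
open import Data.Maybe.Properties using (just-injective)
open import Data.Nat using (zero; suc; _+_; z≤n; s≤s; _≤?_; NonZero; >-nonZero)
open import Data.Nat.Induction using (<-wellFounded)
open import Data.Nat.Properties hiding (_≟_)
open import Data.Nat.Tactic.RingSolver using (solve-∀)
open import Data.Product using (_,_)
open import Data.Sum using (_⊎_; inj₁; inj₂)
open import Data.Vec using (_∷_; lookup; _[_]≔_)
open import Data.Vec.Properties using (lookup⇒[]=; lookup-replicate)
open import Function using (_∘_)
open import Induction.WellFounded using (Acc; acc)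
open import Relation.Binary.PropositionalEquality
open import Relation.Nullary using (yes; no)
open import Relation.Nullary.Decidable using (_×-dec_)

open import Algebra.Properties.CommutativeMonoid.Sum +-0-commutativeMonoid
  using (sum; ∑-comm)
open import Algebra.Properties.CommutativeSemigroup
  (CommutativeMonoid.commutativeSemigroup ∧-commutativeMonoid)
  using () renaming (x∙yz≈y∙xz to x∧[y∧z]≡y∧[x∧z])
open import Algebra.Properties.CommutativeSemigroup +-commutativeSemigroup
  using () renaming (x∙yz≈y∙xz to m+[n+o]≡n+[m+o])

sumF-cong : ∀ {k} {f g : Fin k → ℕ} → (∀ i → f i ≡ g i) → sumF f ≡ sumF g
sumF-cong {zero}  f≗g = refl
sumF-cong {suc k} f≗g = cong₂ _+_ (f≗g zero) (sumF-cong (f≗g ∘ suc))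

sumF-zero : ∀ k → sumF {k} (λ _ → 0) ≡ 0
sumF-zero zero    = refl
sumF-zero (suc k) = sumF-zero k

sumF≡sum : ∀ {k} (f : Fin k → ℕ) → sumF f ≡ sum f
sumF≡sum {zero}  f = refl
sumF≡sum {suc k} f = cong (f zero +_) (sumF≡sum (f ∘ suc))

sumF-comm : ∀ {m n} (f : Fin m → Fin n → ℕ) →
  sumF (λ i → sumF (f i)) ≡ sumF (λ j → sumF (λ i → f i j))
sumF-comm f = begin
  sumF (λ i → sumF (f i))          ≡⟨ sumF-cong (sumF≡sum ∘ f) ⟩
  sumF (λ i → sum (f i))           ≡⟨ sumF≡sum (λ i → sum (f i)) ⟩
  sum (λ i → sum (f i))            ≡⟨ ∑-comm f ⟩
  sum (λ j → sum (λ i → f i j))    ≡⟨ sumF≡sum (λ j → sum (λ i → f i j)) ⟨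
  sumF (λ j → sum (λ i → f i j))   ≡⟨ sumF-cong (λ j → sumF≡sum (λ i → f i j)) ⟨
  sumF (λ j → sumF (λ i → f i j))  ∎
  where open ≡-Reasoning

indicator : Bool → ℕ
indicator b = if b then 1 else 0

count-cong : ∀ {k} {p q : Fin k → Bool} → (∀ i → p i ≡ q i) → count p ≡ count q
count-cong {zero}  p≗q = refl
count-cong {suc k} p≗q = cong₂ _+_ (cong indicator (p≗q zero)) (count-cong (p≗q ∘ suc))

count≡sumF : ∀ {k} (p : Fin k → Bool) → count p ≡ sumF (indicator ∘ p)
count≡sumF {zero}  p = refl
count≡sumF {suc k} p = cong (indicator (p zero) +_) (count≡sumF (p ∘ suc))

if-count : ∀ {k} b (p : Fin k → Bool) →
  (if b then count p else 0) ≡ sumF (λ i → indicator (b ∧ p i))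
if-count     true  p = count≡sumF p
if-count {k} false p = sym (sumF-zero k)

sumOver : ∀ {k} → Subset k → (Fin k → ℕ) → ℕ
sumOver S f = sumF (λ i → if lookup S i then f i else 0)

sumOver-remove : ∀ {k} (S : Subset k) (f : Fin k → ℕ) {v} → lookup S v ≡ true →
  sumOver S f ≡ f v + sumOver (S [ v ]≔ false) f
sumOver-remove (true ∷ S) f {zero}  refl = refl
sumOver-remove (b ∷ S)    f {suc v} v∈S = begin
  f₀ + sumOver S (f ∘ suc)                              ≡⟨ cong (f₀ +_) (sumOver-remove S (f ∘ suc) v∈S) ⟩
  f₀ + (f (suc v) + sumOver (S [ v ]≔ false) (f ∘ suc)) ≡⟨ m+[n+o]≡n+[m+o] f₀ (f (suc v)) _ ⟩
  f (suc v) + (f₀ + sumOver (S [ v ]≔ false) (f ∘ suc)) ∎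
  where
  open ≡-Reasoning
  f₀ = if b then f zero else 0

sumOver-positive : ∀ {k} (S : Subset k) (f : Fin k → ℕ) → 1 ≤ sumOver S f →
  ∃ λ v → lookup S v ≡ true
sumOver-positive (true ∷ S)  f _   = zero , refl
sumOver-positive (false ∷ S) f pos with sumOver-positive S (f ∘ suc) pos
... | v , v∈S = suc v , v∈S

∣∣-remove : ∀ {k} (S : Subset k) {v} → lookup S v ≡ true → ∣ S ∣ ≡ suc ∣ S [ v ]≔ false ∣
∣∣-remove (true ∷ S)  {zero}  refl = refl
∣∣-remove (true ∷ S)  {suc v} v∈S  = cong suc (∣∣-remove S v∈S)
∣∣-remove (false ∷ S) {suc v} v∈S  = ∣∣-remove S v∈S

∣∣-remove-< : ∀ {k} (S : Subset k) {v} → lookup S v ≡ true → ∣ S [ v ]≔ false ∣ < ∣ S ∣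
∣∣-remove-< S v∈S = ≤-reflexive (sym (∣∣-remove S v∈S))

minOver′-attained : ∀ {k} (S : Subset k) (f : Fin k → ℕ) {m} → minOver′ S f ≡ just m →
  ∃ λ w → lookup S w ≡ true × f w ≡ m
minOver′-attained (false ∷ S) f eq with minOver′-attained S (f ∘ suc) eq
... | w , w∈S , fw≡m = suc w , w∈S , fw≡m
minOver′-attained (true ∷ S) f eq with minOver′ S (f ∘ suc) in tail-eq
... | nothing = zero , refl , just-injective eq
... | just m′ with ⊓-sel (f zero) m′
...   | inj₁ f₀⊓m′≡f₀ = zero , refl , trans (sym f₀⊓m′≡f₀) (just-injective eq)
...   | inj₂ f₀⊓m′≡m′ with minOver′-attained S (f ∘ suc) tail-eq
...     | w , w∈S , fw≡m′ =
  suc w , w∈S , trans fw≡m′ (trans (sym f₀⊓m′≡m′) (just-injective eq))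

minOver′-defined : ∀ {k} (S : Subset k) (f : Fin k → ℕ) {v} → lookup S v ≡ true →
  ∃ λ m → minOver′ S f ≡ just m
minOver′-defined (true ∷ S)  f         _   with minOver′ S (f ∘ suc)
... | nothing = _ , refl
... | just _  = _ , refl
minOver′-defined (false ∷ S) f {suc v} v∈S = minOver′-defined S (f ∘ suc) v∈S

minOver-attained : ∀ {k} (S : Subset k) (f : Fin k → ℕ) {v} → lookup S v ≡ true →
  ∃ λ w → lookup S w ≡ true × f w ≡ minOver S f
minOver-attained S f v∈S with minOver′-defined S f v∈S
... | m , eq rewrite eq = minOver′-attained S f eq

All⇒minOver : ∀ {k} (S : Subset k) (f : Fin k → ℕ) (P : ℕ → Set) {v} → lookup S v ≡ true →
  (∀ w → lookup S w ≡ true → P (f w)) → P (minOver S f)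
All⇒minOver S f P v∈S all with minOver-attained S f v∈S
... | w , w∈S , fw≡min = subst P fw≡min (all w w∈S)

_ᵀ : BipartiteGraph → BipartiteGraph
G ᵀ = record { nL = nR G ; nR = nL G ; adj = λ u v → adj G v u }

edgesIn-as-double-sum : ∀ G L R → edgesIn G L R ≡
  sumF (λ v → sumF (λ u → indicator (lookup L v ∧ (lookup R u ∧ adj G v u))))
edgesIn-as-double-sum G L R =
  sumF-cong (λ v → if-count (lookup L v) (λ u → lookup R u ∧ adj G v u))

edgesIn-transpose : ∀ G L R → edgesIn (G ᵀ) R L ≡ edgesIn G L R
edgesIn-transpose G L R = begin
  edgesIn (G ᵀ) R L
    ≡⟨ edgesIn-as-double-sum (G ᵀ) R L ⟩
  sumF (λ u → sumF (λ v → indicator (lookup R u ∧ (lookup L v ∧ adj G v u))))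
    ≡⟨ sumF-comm (λ u v → indicator (lookup R u ∧ (lookup L v ∧ adj G v u))) ⟩
  sumF (λ v → sumF (λ u → indicator (lookup R u ∧ (lookup L v ∧ adj G v u))))
    ≡⟨ sumF-cong (λ v → sumF-cong (λ u →
         cong indicator (x∧[y∧z]≡y∧[x∧z] (lookup R u) (lookup L v) (adj G v u)))) ⟩
  sumF (λ v → sumF (λ u → indicator (lookup L v ∧ (lookup R u ∧ adj G v u))))
    ≡⟨ edgesIn-as-double-sum G L R ⟨
  edgesIn G L R
    ∎
  where open ≡-Reasoning

edgesIn-⊤ : ∀ G → edgesIn G ⊤ ⊤ ≡ numEdges G
edgesIn-⊤ G = sumF-cong λ v → begin
  (if lookup ⊤ v then degL G ⊤ v else 0)
    ≡⟨ cong (λ b → if b then degL G ⊤ v else 0) (lookup-replicate v true) ⟩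
  degL G ⊤ v
    ≡⟨ count-cong (λ u → cong (_∧ adj G v u) (lookup-replicate u true)) ⟩
  count (adj G v)
    ∎
  where open ≡-Reasoning

m^2≡m*m : ∀ m → m ^ 2 ≡ m * m
m^2≡m*m m = cong (m *_) (*-identityʳ m)

m≤n⇒1≤m+n⇒1≤n : ∀ {m n} → m ≤ n → 1 ≤ m + n → 1 ≤ n
m≤n⇒1≤m+n⇒1≤n {n = suc n} _   _ = s≤s z≤n
m≤n⇒1≤m+n⇒1≤n {n = zero}  z≤n ()

low-degree-bound : ∀ {a d k} → 2 * suc k * d ≤ d + a → (1 + 2 * k) * d ≤ a
low-degree-bound {a} {d} {k} low = +-cancelˡ-≤ d _ _ (begin
  d + (1 + 2 * k) * d  ≡⟨ regroup d k ⟩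
  2 * suc k * d        ≤⟨ low ⟩
  d + a                ∎)
  where
  open ≤-Reasoning
  regroup : ∀ d k → d + (1 + 2 * k) * d ≡ 2 * suc k * d
  regroup = solve-∀

square-after-removal : ∀ {a d k} → (1 + 2 * k) * d ≤ a → (d + a) ^ 2 * k ≤ a ^ 2 * suc k
square-after-removal {a} {d} {k} bound = begin
  (d + a) ^ 2 * k                  ≡⟨ cong (_* k) (m^2≡m*m (d + a)) ⟩
  (d + a) * (d + a) * k            ≡⟨ expand d a k ⟩
  a * a * k + d * k * (2 * a + d)  ≤⟨ +-monoʳ-≤ (a * a * k) cross-terms ⟩
  a * a * k + a * a                ≡⟨ collect a k ⟩
  a * a * suc k                    ≡⟨ cong (_* suc k) (m^2≡m*m a) ⟨
  a ^ 2 * suc k                    ∎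
  where
  open ≤-Reasoning
  expand : ∀ d a k → (d + a) * (d + a) * k ≡ a * a * k + d * k * (2 * a + d)
  expand = solve-∀
  collect : ∀ a k → a * a * k + a * a ≡ a * a * suc k
  collect = solve-∀
  regroupˡ : ∀ d k a → d * k * (2 * a + d) ≡ 2 * (d * k) * a + d * k * d
  regroupˡ = solve-∀
  regroupʳ : ∀ d k a → 2 * (d * k) * a + a * d ≡ (1 + 2 * k) * d * a
  regroupʳ = solve-∀
  dk≤a : d * k ≤ a
  dk≤a = begin
    d * k            ≡⟨ *-comm d k ⟩
    k * d            ≤⟨ *-monoˡ-≤ d (m≤n⇒m≤1+n (m≤m+n k (k + 0))) ⟩
    (1 + 2 * k) * d  ≤⟨ bound ⟩
    a                ∎
  cross-terms : d * k * (2 * a + d) ≤ a * a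
  cross-terms = begin
    d * k * (2 * a + d)          ≡⟨ regroupˡ d k a ⟩
    2 * (d * k) * a + d * k * d  ≤⟨ +-monoʳ-≤ (2 * (d * k) * a) (*-monoˡ-≤ d dk≤a) ⟩
    2 * (d * k) * a + a * d      ≡⟨ regroupʳ d k a ⟩
    (1 + 2 * k) * d * a          ≤⟨ *-monoˡ-≤ a bound ⟩
    a * a                        ∎

density-after-removal : ∀ {X N r a d k} → (1 + 2 * k) * d ≤ a →
  X * (suc k * r) ≤ (d + a) ^ 2 * N → X * (k * r) ≤ a ^ 2 * N
density-after-removal {X} {N} {r} {a} {d} {k} bound dense = *-cancelʳ-≤ _ _ (suc k) (begin
  X * (k * r) * suc k   ≡⟨ exchange X k r ⟩
  X * (suc k * r) * k   ≤⟨ *-monoˡ-≤ k dense ⟩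
  (d + a) ^ 2 * N * k   ≡⟨ *-rightComm ((d + a) ^ 2) N k ⟩
  (d + a) ^ 2 * k * N   ≤⟨ *-monoˡ-≤ N (square-after-removal bound) ⟩
  a ^ 2 * suc k * N     ≡⟨ *-rightComm (a ^ 2) (suc k) N ⟩
  a ^ 2 * N * suc k     ∎)
  where
  open ≤-Reasoning
  exchange : ∀ X k r → X * (k * r) * suc k ≡ X * (suc k * r) * k
  exchange = solve-∀
  *-rightComm : ∀ x y z → x * y * z ≡ x * z * y
  *-rightComm = solve-∀

density-bound : ∀ {E e l r nL nR p q} → 1 ≤ E → 1 ≤ l → 1 ≤ r →
  E ^ 2 * (l * r) ≤ e ^ 2 * (nL * nR) → e < 2 * l * p → e < 2 * r * q →
  E ^ 2 < 4 * nL * nR * (p * q)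
density-bound {E} {e} {l} {r} {nL} {nR} {p} {q} E≥1 l≥1 r≥1 dense e<2lp e<2rq =
  *-cancelʳ-< (l * r) _ _ (begin-strict
    E ^ 2 * (l * r)                      ≤⟨ dense ⟩
    e ^ 2 * (nL * nR)                    ≡⟨ cong (_* (nL * nR)) (m^2≡m*m e) ⟩
    e * e * (nL * nR)                    <⟨ *-monoˡ-< (nL * nR) {{N≢0}} (*-mono-< e<2lp e<2rq) ⟩
    2 * l * p * (2 * r * q) * (nL * nR)  ≡⟨ regroup l r p q nL nR ⟩
    4 * nL * nR * (p * q) * (l * r)      ∎)
  where
  open ≤-Reasoning
  regroup : ∀ l r p q nL nR → 2 * l * p * (2 * r * q) * (nL * nR) ≡ 4 * nL * nR * (p * q) * (l * r)
  regroup = solve-∀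
  positive : 1 ≤ E ^ 2 * (l * r)
  positive = *-mono-≤ (*-mono-≤ E≥1 (*-mono-≤ E≥1 ≤-refl)) (*-mono-≤ l≥1 r≥1)
  N≢0 : NonZero (nL * nR)
  N≢0 = m*n≢0⇒n≢0 (e ^ 2) {{>-nonZero (≤-trans positive dense)}}

record Dense (X N : ℕ) (G : BipartiteGraph) (L : Subset (nL G)) (R : Subset (nR G)) : Set where
  field
    has-edge : 1 ≤ edgesIn G L R
    density  : X * (∣ L ∣ * ∣ R ∣) ≤ edgesIn G L R ^ 2 * N

Dense-⊤ : ∀ G → 1 ≤ numEdges G → Dense (numEdges G ^ 2) (nL G * nR G) G ⊤ ⊤
Dense-⊤ G E≥1 = record
  { has-edge = subst (1 ≤_) (sym (edgesIn-⊤ G)) E≥1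
  ; density  = ≤-reflexive (cong₂ (λ e s → e ^ 2 * s)
                 (sym (edgesIn-⊤ G)) (cong₂ _*_ (∣⊤∣≡n (nL G)) (∣⊤∣≡n (nR G))))
  }

Dense-transpose : ∀ {X N G L R} → Dense X N G L R → Dense X N (G ᵀ) R L
Dense-transpose {X} {N} {G} {L} {R} record { has-edge = has-edge ; density = density } = record
  { has-edge = subst (1 ≤_) (sym (edgesIn-transpose G L R)) has-edge
  ; density  = subst₂ (λ s e → X * s ≤ e ^ 2 * N)
                 (*-comm ∣ L ∣ ∣ R ∣) (sym (edgesIn-transpose G L R)) density
  }

Dense-removeL : ∀ {X N G L R v} → Dense X N G L R → lookup L v ≡ true →
  2 * ∣ L ∣ * degL G R v ≤ edgesIn G L R → Dense X N G (L [ v ]≔ false) R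
Dense-removeL {X} {N} {G} {L} {R} {v} record { has-edge = has-edge ; density = density } v∈L low
  with ∣ L ∣ | ∣∣-remove L v∈L | edgesIn G L R | sumOver-remove L (degL G R) v∈L
... | _ | refl | _ | refl = record
  { has-edge = m≤n⇒1≤m+n⇒1≤n (≤-trans (m≤n*m _ (1 + 2 * ∣ L′ ∣)) bound) has-edge
  ; density  = density-after-removal {X} {N} {∣ R ∣} {d = degL G R v} {k = ∣ L′ ∣} bound density
  }
  where
  L′ = L [ v ]≔ false
  bound : (1 + 2 * ∣ L′ ∣) * degL G R v ≤ edgesIn G L′ R
  bound = low-degree-bound {k = ∣ L′ ∣} low

MinDegreeL : (G : BipartiteGraph) → Subset (nL G) → Subset (nR G) → Set
MinDegreeL G L R = ∀ v → lookup L v ≡ true → edgesIn G L R < 2 * ∣ L ∣ * degL G R v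

low-degree-or-MinDegreeL : ∀ G L R →
  (∃ λ v → lookup L v ≡ true × 2 * ∣ L ∣ * degL G R v ≤ edgesIn G L R) ⊎ MinDegreeL G L R
low-degree-or-MinDegreeL G L R
  with any? (λ v → (lookup L v ≟ true) ×-dec (2 * ∣ L ∣ * degL G R v ≤? edgesIn G L R))
... | yes low = inj₁ low
... | no ¬low = inj₂ (λ v v∈L → ≰⇒> (λ low → ¬low (v , v∈L , low)))

-- A vertex of R is a vertex of L of the transposed graph, so both kinds of
-- deletion are handled by Dense-removeL.
trim : ∀ {X N} G L R → Acc _<_ (∣ L ∣ + ∣ R ∣) → Dense X N G L R →
  ∃₂ λ L′ R′ → Dense X N G L′ R′ × MinDegreeL G L′ R′ × MinDegreeL (G ᵀ) R′ L′
trim G L R (acc smaller) dense with low-degree-or-MinDegreeL G L R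
... | inj₁ (v , v∈L , low) =
  trim G (L [ v ]≔ false) R (smaller (+-monoˡ-< ∣ R ∣ (∣∣-remove-< L v∈L)))
    (Dense-removeL dense v∈L low)
... | inj₂ minL with low-degree-or-MinDegreeL (G ᵀ) R L
...   | inj₁ (u , u∈R , low) =
  trim G L (R [ u ]≔ false) (smaller (+-monoʳ-< ∣ L ∣ (∣∣-remove-< R u∈R)))
    (Dense-transpose (Dense-removeL (Dense-transpose dense) u∈R low))
...   | inj₂ minR = L , R , dense , minL , minR

lemma2p2 : (G : BipartiteGraph) → 1 ≤ numEdges G →
    ∃₂ λ (L' : Subset (nL G)) (R' : Subset (nR G)) →
      Nonempty L' × Nonempty R' ×
      (numEdges G ^ 2 < 4 * nL G * nR G * (minOver L' (degL G R') * minOver R' (degR G L'))) ×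
      (numEdges G ^ 2 * (∣ L' ∣ * ∣ R' ∣) ≤ edgesIn G L' R' ^ 2 * (nL G * nR G))
lemma2p2 G E≥1 with trim G ⊤ ⊤ (<-wellFounded _) (Dense-⊤ G E≥1)
... | L , R , dense , minL , minR
  with sumOver-positive L (degL G R) (Dense.has-edge dense)
     | sumOver-positive R (degR G L) (Dense.has-edge (Dense-transpose dense))
... | v , v∈L | u , u∈R =
  L , R , (v , lookup⇒[]= v L v∈L) , (u , lookup⇒[]= u R u∈R) ,
  density-bound {nL = nL G} {nR = nR G} E≥1
    (≤-trans (s≤s z≤n) (∣∣-remove-< L v∈L)) (≤-trans (s≤s z≤n) (∣∣-remove-< R u∈R))
    (Dense.density dense)
    (All⇒minOver L (degL G R) (λ m → edgesIn G L R < 2 * ∣ L ∣ * m) v∈L minL)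
    (All⇒minOver R (degR G L) (λ m → edgesIn G L R < 2 * ∣ R ∣ * m) u∈R minR′) ,
  Dense.density dense
  where
  minR′ : ∀ u → lookup R u ≡ true → edgesIn G L R < 2 * ∣ R ∣ * degR G L u
  minR′ u u∈R = subst (_< 2 * ∣ R ∣ * degR G L u) (edgesIn-transpose G L R) (minR u u∈R)
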